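{- Let $P_1$ and $P_2$ be two disjoint finite posets such that $P_1$ has a unique maximal element $u$ and $P_2$ has a unique minimal element $v$. Let $P_1\diamond P_2$ be the poset obtained by gluing $u$ and $v$ together in the Hasse diagram. Then \[ \mathrm{Ehr}(\mathcal{O}(P_1\diamond P_2),x)=\mathrm{Ehr}(\mathcal{O}(P_1),x)\cdot\mathrm{Ehr}(\mathcal{O}(P_2),x)\cdot(1-x)^2. \]
   Context: For a finite poset $(P,\preceq)$ on $[p]$, the order polytope $\mathcal{O}(P)\subset\mathbb{R}^p$ is defined by $0\le x_i\le 1$ and $x_i\le x_j$ whenever $i\prec j$. For an integral polytope $\mathcal{Q}\subset\mathbb{R}^p$, $\mathrm{ehr}(\mathcal{Q},n)=|n\mathcal{Q}\cap\mathbb{Z}^p|$ ($n\ge1$), and $\mathrm{Ehr}(\mathcal{Q},x)=1+\sum_{n\ge1}\mathrm{ehr}(\mathcal{Q},n)x^n$. The glued poset $P_1\diamond P_2$ has underlying set $(P_1\setminus\{u\})\uplus P_2$ (with $v$ playing the role of the identified element $u=v$), and $s\preceq t$ iff $s,t\in P_1$ (reading $v$ as $u$) and $s\preceq t$ in $P_1$, or $s,t\in P_2$ and $s\preceq t$ in $P_2$, or $s\in P_1\setminus\{u\}$ and $t\in P_2$. -}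

module Defs where

open import Level using (0ℓ)
open import Data.Nat as ℕ using (ℕ; zero; suc)
open import Data.Integer as ℤ using (ℤ; +_; _≤?_)
open import Data.Fin as Fin using (Fin; punchIn; splitAt)
open import Data.Fin.Properties using (all?) renaming (_≟_ to _≟ᶠ_)
open import Data.Vec as Vec using (Vec; []; _∷_; lookup)
open import Data.List as List using (List; []; _∷_; length; filter; concatMap; upTo)
open import Data.Sum using (inj₁; inj₂)
open import Data.Product using (_×_; _,_)
open import Data.Unit using (⊤; tt)
open import Data.Empty using (⊥)
open import Relation.Nullary using (Dec; yes; no; ¬_)
open import Relation.Nullary.Decidable using (_×-dec_; _→-dec_; ¬?)
open import Relation.Binary using (Rel; Decidable; IsPartialOrder)
open import Relation.Binary.PropositionalEquality using (_≡_; _≢_)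

record FinPoset (p : ℕ) : Set₁ where
  field
    _≼_            : Rel (Fin p) 0ℓ
    _≼?_           : Decidable _≼_
    isPartialOrder : IsPartialOrder _≡_ _≼_

Strict : ∀ {p} → Rel (Fin p) 0ℓ → Rel (Fin p) 0ℓ
Strict R i j = R i j × (i ≢ j)

strict? : ∀ {p} {R : Rel (Fin p) 0ℓ} → Decidable R → Decidable (Strict R)
strict? R? i j = R? i j ×-dec ¬? (i ≟ᶠ j)

IsMaximal : ∀ {p} → FinPoset p → Fin p → Set
IsMaximal P u = ∀ t → ¬ Strict (FinPoset._≼_ P) u t

IsMinimal : ∀ {p} → FinPoset p → Fin p → Set
IsMinimal P v = ∀ t → ¬ Strict (FinPoset._≼_ P) t v

UniqueMaximal : ∀ {p} → FinPoset p → Fin p → Set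
UniqueMaximal P u = IsMaximal P u × (∀ w → IsMaximal P w → w ≡ u)

UniqueMinimal : ∀ {p} → FinPoset p → Fin p → Set
UniqueMinimal P v = IsMinimal P v × (∀ w → IsMinimal P w → w ≡ v)

InDilatedOrderPolytope : ∀ {p} → Rel (Fin p) 0ℓ → ℕ → Vec ℤ p → Set
InDilatedOrderPolytope {p} R n x =
  (∀ i → (+ 0 ℤ.≤ lookup x i) × (lookup x i ℤ.≤ + n))
  × (∀ i j → Strict R i j → lookup x i ℤ.≤ lookup x j)

inDilated? : ∀ {p} {R : Rel (Fin p) 0ℓ} → Decidable R → (n : ℕ) → (x : Vec ℤ p) →
             Dec (InDilatedOrderPolytope R n x)
inDilated? R? n x =
  all? (λ i → (+ 0 ≤? lookup x i) ×-dec (lookup x i ≤? + n))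
  ×-dec all? (λ i → all? (λ j → strict? R? i j →-dec (lookup x i ≤? lookup x j)))

-- All integer vectors in the box {0,…,n}^p (each listed exactly once);
-- every integer point of n·O(P) lies in this box.
box : ℕ → (p : ℕ) → List (Vec ℤ p)
box n zero    = [] ∷ []
box n (suc p) = concatMap (λ c → List.map (c ∷_) (box n p)) (List.map +_ (upTo (suc n)))

ehrO : ∀ {p} {R : Rel (Fin p) 0ℓ} → Decidable R → ℕ → ℕ
ehrO {p} R? n = length (filter (inDilated? R? n) (box n p))

Series : Set
Series = ℕ → ℤ

EhrO : ∀ {p} {R : Rel (Fin p) 0ℓ} → Decidable R → Series
EhrO R? zero    = + 1
EhrO R? (suc n) = + ehrO R? (suc n)

sumTo : ℕ → (ℕ → ℤ) → ℤ
sumTo zero    f = f 0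
sumTo (suc n) f = sumTo n f ℤ.+ f (suc n)

_⊛_ : Series → Series → Series
(a ⊛ b) n = sumTo n (λ k → a k ℤ.* b (n ℕ.∸ k))

oneMinusXSq : Series
oneMinusXSq 0 = + 1
oneMinusXSq 1 = ℤ.- (+ 2)
oneMinusXSq 2 = + 1
oneMinusXSq (suc (suc (suc _))) = + 0

-- Underlying set of P₁ ⋄ P₂ is Fin (m + q): the first m elements are
-- P₁ ∖ {u} (embedded via punchIn u), the last q are P₂ (v included).

module _ {m q : ℕ} (P₁ : FinPoset (suc m)) (u : Fin (suc m)) (P₂ : FinPoset q) where
  private
    module P₁ = FinPoset P₁
    module P₂ = FinPoset P₂

  GlueRel : Rel (Fin (m ℕ.+ q)) 0ℓ
  GlueRel s t with splitAt m s | splitAt m t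
  ... | inj₁ a | inj₁ b = punchIn u a P₁.≼ punchIn u b
  ... | inj₂ a | inj₂ b = a P₂.≼ b
  ... | inj₁ _ | inj₂ _ = ⊤
  ... | inj₂ _ | inj₁ _ = ⊥

  glueRel? : Decidable GlueRel
  glueRel? s t with splitAt m s | splitAt m t
  ... | inj₁ a | inj₁ b = punchIn u a P₁.≼? punchIn u b
  ... | inj₂ a | inj₂ b = a P₂.≼? b
  ... | inj₁ _ | inj₂ _ = yes tt
  ... | inj₂ _ | inj₁ _ = no (λ ())

{-# OPTIONS --safe #-}
-- Since u is the greatest element of P₁, the points of n·O(P₁) with x_u = k are exactly the points
-- of k·O(P₁) with x_u = k; call their number α k, so ehr(O(P₁), n) = Σ_{k ≤ n} α k.  Dually v is
-- least in P₂, and translation by k identifies the points of n·O(P₂) with x_v = k with the points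
-- of (n - k)·O(P₂) with x_v = 0, counted by β (n - k); so ehr(O(P₂), n) = Σ_{k ≤ n} β k.  In P₁ ⋄ P₂
-- every element of P₁ ∖ {u} lies below every element of P₂, so a point of n·O(P₁ ⋄ P₂) is a pair of
-- such points sharing the glued coordinate k, and ehr(O(P₁ ⋄ P₂), n) = Σ_k α k β (n - k).  As series,
-- Ehr(O(P₁)) = A/(1 - x), Ehr(O(P₂)) = B/(1 - x) and Ehr(O(P₁ ⋄ P₂)) = AB.
module Submission where

open import Defs
open import Level using (0ℓ)
open import Data.Nat.Base as ℕ
  using (ℕ; zero; suc; _∸_; _≤_; _<_; _≤′_; ≤′-refl; ≤′-step; z≤n; s≤s)
import Data.Nat.Properties as ℕₚ
open import Data.Integer.Base as ℤ using (ℤ; +_; _+_; _*_; _-_; -_; +≤+)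
import Data.Integer.Properties as ℤₚ
open import Data.Integer.Tactic.RingSolver using (solve-∀)
open import Data.Fin.Base using (Fin; zero; suc; punchIn; punchOut; splitAt; _↑ˡ_; _↑ʳ_)
open import Data.Fin.Properties
  using (any?; punchIn-punchOut; punchIn-injective; ↑ˡ-injective; ↑ʳ-injective;
         splitAt-↑ˡ; splitAt-↑ʳ; splitAt⁻¹-↑ˡ; splitAt⁻¹-↑ʳ)
  renaming (_≟_ to _≟ᶠ_)
open import Data.Fin.Induction using (po-noetherian)
open import Data.Vec.Base using (Vec; []; _∷_; lookup; insertAt; _++_; map; replicate)
open import Data.Vec.Properties
  using (insertAt-lookup; insertAt-punchIn; lookup-map; lookup-++ˡ; lookup-++ʳ; lookup-replicate;
         map-insertAt)
open import Data.List.Base as List using (List; []; _∷_; length; filter; concatMap; applyUpTo; upTo)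
open import Data.Product.Base using (_×_; _,_; proj₁; proj₂)
open import Data.Sum.Base using (inj₁; inj₂)
open import Data.Empty using (⊥-elim)
open import Function.Base using (_∘_; flip)
open import Function.Bundles using (_⇔_; mk⇔; Equivalence)
open import Induction.WellFounded using (Acc; acc)
open import Relation.Nullary using (Dec; yes; no; ¬_)
open import Relation.Nullary.Decidable using (_×-dec_)
open import Relation.Binary using (Rel; Decidable; IsPartialOrder)
import Relation.Binary.Construct.Flip.EqAndOrd as Flip
open import Relation.Binary.PropositionalEquality
  using (_≡_; _≢_; refl; sym; trans; cong; cong₂; subst; subst₂; module ≡-Reasoning)
open ≡-Reasoning

-- Finite sums

sumTo-cong : ∀ n {f g : ℕ → ℤ} → (∀ k → k ≤ n → f k ≡ g k) → sumTo n f ≡ sumTo n g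
sumTo-cong zero    f≗g = f≗g 0 z≤n
sumTo-cong (suc n) f≗g =
  cong₂ _+_ (sumTo-cong n (λ k k≤n → f≗g k (ℕₚ.m≤n⇒m≤1+n k≤n))) (f≗g (suc n) ℕₚ.≤-refl)

sumTo-distrib-+ : ∀ n (f g : ℕ → ℤ) → sumTo n (λ k → f k + g k) ≡ sumTo n f + sumTo n g
sumTo-distrib-+ zero    f g = refl
sumTo-distrib-+ (suc n) f g = begin
  sumTo n (λ k → f k + g k) + (f (suc n) + g (suc n))
    ≡⟨ cong (_+ (f (suc n) + g (suc n))) (sumTo-distrib-+ n f g) ⟩
  (sumTo n f + sumTo n g) + (f (suc n) + g (suc n))
    ≡⟨ interchange (sumTo n f) (sumTo n g) _ _ ⟩
  (sumTo n f + f (suc n)) + (sumTo n g + g (suc n))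
    ∎
  where
  interchange : ∀ a b c d → (a + b) + (c + d) ≡ (a + c) + (b + d)
  interchange = solve-∀

sumTo-head-tail : ∀ n (f : ℕ → ℤ) → sumTo (suc n) f ≡ f 0 + sumTo n (f ∘ suc)
sumTo-head-tail zero    f = refl
sumTo-head-tail (suc n) f = begin
  sumTo (suc n) f + f (suc (suc n))             ≡⟨ cong (_+ f (suc (suc n))) (sumTo-head-tail n f) ⟩
  (f 0 + sumTo n (f ∘ suc)) + f (suc (suc n))  ≡⟨ ℤₚ.+-assoc (f 0) _ _ ⟩
  f 0 + sumTo (suc n) (f ∘ suc)                ∎

sumTo-reverse : ∀ n (f : ℕ → ℤ) → sumTo n f ≡ sumTo n (λ k → f (n ∸ k))
sumTo-reverse zero    f = refl
sumTo-reverse (suc n) f = begin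
  sumTo n f + f (suc n)                      ≡⟨ ℤₚ.+-comm (sumTo n f) _ ⟩
  f (suc n) + sumTo n f                      ≡⟨ cong (_+_ (f (suc n))) (sumTo-reverse n f) ⟩
  f (suc n) + sumTo n (λ k → f (n ∸ k))      ≡⟨ sumTo-head-tail n (λ k → f (suc n ∸ k)) ⟨
  sumTo (suc n) (λ k → f (suc n ∸ k))        ∎

sumTo-comm : ∀ a b (f : ℕ → ℕ → ℤ) →
             sumTo a (λ i → sumTo b (f i)) ≡ sumTo b (λ j → sumTo a (λ i → f i j))
sumTo-comm zero    b f = refl
sumTo-comm (suc a) b f = begin
  sumTo a (λ i → sumTo b (f i)) + sumTo b (f (suc a))
    ≡⟨ cong (_+ sumTo b (f (suc a))) (sumTo-comm a b f) ⟩
  sumTo b (λ j → sumTo a (λ i → f i j)) + sumTo b (f (suc a))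
    ≡⟨ sumTo-distrib-+ b _ _ ⟨
  sumTo b (λ j → sumTo (suc a) (λ i → f i j))
    ∎

sumTo-last : ∀ n (f : ℕ → ℤ) → (∀ k → k < n → f k ≡ + 0) → sumTo n f ≡ f n
sumTo-last zero    f _     = refl
sumTo-last (suc n) f below = begin
  sumTo n f + f (suc n)  ≡⟨ cong (_+ f (suc n)) (trans (sumTo-last n f below′) (below n ℕₚ.≤-refl)) ⟩
  + 0 + f (suc n)        ≡⟨ ℤₚ.+-identityˡ _ ⟩
  f (suc n)              ∎
  where
  below′ : ∀ k → k < n → f k ≡ + 0
  below′ k k<n = below k (ℕₚ.m<n⇒m<1+n k<n)

sumTo-restrict : ∀ {w n} (f : ℕ → ℤ) → w ≤′ n → (∀ d → w < d → f d ≡ + 0) →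
                 sumTo n f ≡ sumTo w f
sumTo-restrict f ≤′-refl           above = refl
sumTo-restrict {w} f (≤′-step {n} w≤n) above = begin
  sumTo n f + f (suc n)
    ≡⟨ cong₂ _+_ (sumTo-restrict f w≤n above) (above (suc n) (s≤s (ℕₚ.≤′⇒≤ w≤n))) ⟩
  sumTo w f + + 0
    ≡⟨ ℤₚ.+-identityʳ _ ⟩
  sumTo w f
    ∎

sumTo-shift : ∀ lo {w n} (f : ℕ → ℤ) → lo ℕ.+ w ≤ n →
              (∀ d → d < lo → f d ≡ + 0) → (∀ d → lo ℕ.+ w < d → f d ≡ + 0) →
              sumTo n f ≡ sumTo w (λ e → f (lo ℕ.+ e))
sumTo-shift zero    f w≤n _ above = sumTo-restrict f (ℕₚ.≤⇒≤′ w≤n) above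
sumTo-shift (suc lo) {w} {suc n} f (s≤s le) below above = begin
  sumTo (suc n) f                               ≡⟨ sumTo-head-tail n f ⟩
  f 0 + sumTo n (f ∘ suc)                       ≡⟨ cong₂ _+_ (below 0 (s≤s z≤n)) shifted ⟩
  + 0 + sumTo w (λ e → f (suc lo ℕ.+ e))        ≡⟨ ℤₚ.+-identityˡ _ ⟩
  sumTo w (λ e → f (suc lo ℕ.+ e))              ∎
  where
  shifted = sumTo-shift lo (f ∘ suc) le (λ d d<lo → below (suc d) (s≤s d<lo))
                                        (λ d d>hi → above (suc d) (s≤s d>hi))

sumOver : {A : Set} → List A → (A → ℤ) → ℤ
sumOver []       f = + 0
sumOver (x ∷ xs) f = f x + sumOver xs f

infix 5 sumOver
syntax sumOver xs (λ x → e) = ∑[ x ∈ xs ] e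

module _ {A : Set} where

  ∑-cong : ∀ (xs : List A) {f g : A → ℤ} → (∀ x → f x ≡ g x) →
           ∑[ x ∈ xs ] f x ≡ ∑[ x ∈ xs ] g x
  ∑-cong []       f≗g = refl
  ∑-cong (x ∷ xs) f≗g = cong₂ _+_ (f≗g x) (∑-cong xs f≗g)

  ∑-zero : ∀ (xs : List A) {f : A → ℤ} → (∀ x → f x ≡ + 0) → ∑[ x ∈ xs ] f x ≡ + 0
  ∑-zero []       f≗0 = refl
  ∑-zero (x ∷ xs) f≗0 = cong₂ _+_ (f≗0 x) (∑-zero xs f≗0)

  ∑-++ : ∀ (xs ys : List A) (f : A → ℤ) →
         ∑[ x ∈ xs List.++ ys ] f x ≡ (∑[ x ∈ xs ] f x) + (∑[ y ∈ ys ] f y)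
  ∑-++ []       ys f = sym (ℤₚ.+-identityˡ _)
  ∑-++ (x ∷ xs) ys f = trans (cong (_+_ (f x)) (∑-++ xs ys f)) (sym (ℤₚ.+-assoc (f x) _ _))

  ∑-distrib-+ : ∀ (xs : List A) (f g : A → ℤ) →
                ∑[ x ∈ xs ] (f x + g x) ≡ (∑[ x ∈ xs ] f x) + (∑[ x ∈ xs ] g x)
  ∑-distrib-+ []       f g = refl
  ∑-distrib-+ (x ∷ xs) f g =
    trans (cong (_+_ (f x + g x)) (∑-distrib-+ xs f g)) (interchange (f x) (g x) _ _)
    where
    interchange : ∀ a b c d → (a + b) + (c + d) ≡ (a + c) + (b + d)
    interchange = solve-∀

  ∑-*ˡ : ∀ (xs : List A) c (f : A → ℤ) → ∑[ x ∈ xs ] (c * f x) ≡ c * (∑[ x ∈ xs ] f x)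
  ∑-*ˡ []       c f = sym (ℤₚ.*-zeroʳ c)
  ∑-*ˡ (x ∷ xs) c f = trans (cong (_+_ (c * f x)) (∑-*ˡ xs c f)) (sym (ℤₚ.*-distribˡ-+ c (f x) _))

  ∑-*ʳ : ∀ (xs : List A) c (f : A → ℤ) → ∑[ x ∈ xs ] (f x * c) ≡ (∑[ x ∈ xs ] f x) * c
  ∑-*ʳ []       c f = refl
  ∑-*ʳ (x ∷ xs) c f = trans (cong (_+_ (f x * c)) (∑-*ʳ xs c f)) (sym (ℤₚ.*-distribʳ-+ c (f x) _))

  ∑-map : ∀ {B : Set} (h : B → A) (ys : List B) (f : A → ℤ) →
          ∑[ x ∈ List.map h ys ] f x ≡ ∑[ y ∈ ys ] f (h y)
  ∑-map h []       f = refl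
  ∑-map h (y ∷ ys) f = cong (_+_ (f (h y))) (∑-map h ys f)

  ∑-concatMap : ∀ {B : Set} (h : B → List A) (ys : List B) (f : A → ℤ) →
                ∑[ x ∈ concatMap h ys ] f x ≡ ∑[ y ∈ ys ] ∑[ x ∈ h y ] f x
  ∑-concatMap h []       f = refl
  ∑-concatMap h (y ∷ ys) f =
    trans (∑-++ (h y) _ f) (cong (_+_ (∑[ x ∈ h y ] f x)) (∑-concatMap h ys f))

  ∑-applyUpTo : ∀ n (h : ℕ → A) (f : A → ℤ) →
                ∑[ x ∈ applyUpTo h (suc n) ] f x ≡ sumTo n (f ∘ h)
  ∑-applyUpTo zero    h f = ℤₚ.+-identityʳ (f (h 0))
  ∑-applyUpTo (suc n) h f =
    trans (cong (_+_ (f (h 0))) (∑-applyUpTo n (h ∘ suc) f)) (sym (sumTo-head-tail n (f ∘ h)))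

∑-comm : ∀ {A B : Set} (xs : List A) (ys : List B) (f : A → B → ℤ) →
         ∑[ x ∈ xs ] ∑[ y ∈ ys ] f x y ≡ ∑[ y ∈ ys ] ∑[ x ∈ xs ] f x y
∑-comm []       ys f = sym (∑-zero ys (λ _ → refl))
∑-comm (x ∷ xs) ys f =
  trans (cong (_+_ (∑[ y ∈ ys ] f x y)) (∑-comm xs ys f)) (sym (∑-distrib-+ ys (f x) _))

-- Power series

partialSums : Series → Series
partialSums a n = sumTo n a

-- Multiplication by 1 - x.
Δ : Series → Series
Δ a zero    = a zero
Δ a (suc n) = a (suc n) - a n

Δ-cong : ∀ {a b : Series} → (∀ n → a n ≡ b n) → ∀ n → Δ a n ≡ Δ b n
Δ-cong a≗b zero    = a≗b 0
Δ-cong a≗b (suc n) = cong₂ _-_ (a≗b (suc n)) (a≗b n)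

⊛-cong : ∀ {a a′ b b′ : Series} → (∀ k → a k ≡ a′ k) → (∀ k → b k ≡ b′ k) →
         ∀ n → (a ⊛ b) n ≡ (a′ ⊛ b′) n
⊛-cong a≗a′ b≗b′ n = sumTo-cong n (λ k _ → cong₂ _*_ (a≗a′ k) (b≗b′ (n ∸ k)))

⊛-comm : ∀ (a b : Series) n → (a ⊛ b) n ≡ (b ⊛ a) n
⊛-comm a b n = begin
  sumTo n (λ k → a k * b (n ∸ k))                 ≡⟨ sumTo-reverse n _ ⟩
  sumTo n (λ k → a (n ∸ k) * b (n ∸ (n ∸ k)))     ≡⟨ sumTo-cong n swap ⟩
  sumTo n (λ k → b k * a (n ∸ k))                 ∎
  where
  swap : ∀ k → k ≤ n → a (n ∸ k) * b (n ∸ (n ∸ k)) ≡ b k * a (n ∸ k)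
  swap k k≤n rewrite ℕₚ.m∸[m∸n]≡n k≤n = ℤₚ.*-comm (a (n ∸ k)) (b k)

⊛-partialSums-suc : ∀ (a h : Series) n →
                    (a ⊛ partialSums h) (suc n) ≡ (a ⊛ partialSums h) n + (a ⊛ h) (suc n)
⊛-partialSums-suc a h n = begin
  sumTo n (λ k → a k * partialSums h (suc n ∸ k)) + a (suc n) * partialSums h (n ∸ n)
    ≡⟨ cong₂ _+_ (trans (sumTo-cong n split) (sumTo-distrib-+ n _ _)) last ⟩
  (sumTo n (λ k → a k * partialSums h (n ∸ k)) + sumTo n (λ k → a k * h (suc n ∸ k)))
    + a (suc n) * h (n ∸ n)
    ≡⟨ ℤₚ.+-assoc (sumTo n (λ k → a k * partialSums h (n ∸ k))) _ _ ⟩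
  (a ⊛ partialSums h) n + (a ⊛ h) (suc n)
    ∎
  where
  split : ∀ k → k ≤ n →
          a k * partialSums h (suc n ∸ k) ≡ a k * partialSums h (n ∸ k) + a k * h (suc n ∸ k)
  split k k≤n rewrite ℕₚ.+-∸-assoc 1 k≤n = ℤₚ.*-distribˡ-+ (a k) _ _
  last : a (suc n) * partialSums h (n ∸ n) ≡ a (suc n) * h (n ∸ n)
  last rewrite ℕₚ.n∸n≡0 n = refl

Δ-⊛-partialSums : ∀ (a h : Series) n → Δ (a ⊛ partialSums h) n ≡ (a ⊛ h) n
Δ-⊛-partialSums a h zero    = refl
Δ-⊛-partialSums a h (suc n) = begin
  S (suc n) - S n                    ≡⟨ cong (_- S n) (⊛-partialSums-suc a h n) ⟩
  (S n + (a ⊛ h) (suc n)) - S n      ≡⟨ cancel (S n) _ ⟩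
  (a ⊛ h) (suc n)                    ∎
  where
  S = a ⊛ partialSums h
  cancel : ∀ x y → (x + y) - x ≡ y
  cancel = solve-∀

⊛-oneMinusXSq : ∀ (c : Series) n → (c ⊛ oneMinusXSq) n ≡ Δ (Δ c) n
⊛-oneMinusXSq c zero          = ℤₚ.*-identityʳ (c 0)
⊛-oneMinusXSq c (suc zero)    = expand (c 0) (c 1)
  where
  expand : ∀ x y → x * - + 2 + y * + 1 ≡ (y - x) - x
  expand = solve-∀
⊛-oneMinusXSq c (suc (suc n)) = begin
  (sumTo n f + c (suc n) * oneMinusXSq (suc n ∸ n)) + c (suc (suc n)) * oneMinusXSq (n ∸ n)
    ≡⟨ cong₂ (λ s t → (s + c (suc n) * oneMinusXSq t) + c (suc (suc n)) * oneMinusXSq (n ∸ n))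
             lowTerms (ℕₚ.m+n∸n≡m 1 n) ⟩
  (c n * oneMinusXSq (2 ℕ.+ n ∸ n) + c (suc n) * - + 2) + c (suc (suc n)) * oneMinusXSq (n ∸ n)
    ≡⟨ cong₂ (λ s t → (c n * oneMinusXSq s + c (suc n) * - + 2) + c (suc (suc n)) * oneMinusXSq t)
             (ℕₚ.m+n∸n≡m 2 n) (ℕₚ.n∸n≡0 n) ⟩
  (c n * + 1 + c (suc n) * - + 2) + c (suc (suc n)) * + 1
    ≡⟨ expand (c n) (c (suc n)) (c (suc (suc n))) ⟩
  (c (suc (suc n)) - c (suc n)) - (c (suc n) - c n)
    ∎
  where
  f : ℕ → ℤ
  f k = c k * oneMinusXSq (suc (suc n) ∸ k)
  -- for k < n, 2 + n ∸ k ≥ 3 is beyond the degree of (1 - x)²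
  lowTerms : sumTo n f ≡ f n
  lowTerms = sumTo-last n f (λ k k<n →
    trans (cong (λ e → c k * oneMinusXSq e) (ℕₚ.+-∸-assoc 3 k<n)) (ℤₚ.*-zeroʳ (c k)))
  expand : ∀ x y z → (x * + 1 + y * - + 2) + z * + 1 ≡ (z - y) - (y - x)
  expand = solve-∀

partialSums-⊛-oneMinusXSq : ∀ (a b : Series) n →
                            ((partialSums a ⊛ partialSums b) ⊛ oneMinusXSq) n ≡ (a ⊛ b) n
partialSums-⊛-oneMinusXSq a b n = begin
  ((partialSums a ⊛ partialSums b) ⊛ oneMinusXSq) n ≡⟨ ⊛-oneMinusXSq _ n ⟩
  Δ (Δ (partialSums a ⊛ partialSums b)) n           ≡⟨ Δ-cong once n ⟩
  Δ (b ⊛ partialSums a) n                           ≡⟨ Δ-⊛-partialSums b a n ⟩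
  (b ⊛ a) n                                         ≡⟨ ⊛-comm b a n ⟩
  (a ⊛ b) n                                         ∎
  where
  once : ∀ k → Δ (partialSums a ⊛ partialSums b) k ≡ (b ⊛ partialSums a) k
  once k = trans (Δ-⊛-partialSums (partialSums a) b k) (⊛-comm (partialSums a) b k)

-- Integer points of boxes and order polytopes

InRange : ℕ → ℕ → ℤ → Set
InRange lo hi t = (+ lo ℤ.≤ t) × (t ℤ.≤ + hi)

-- Bounded 0 n x is definitionally the box condition in InDilatedOrderPolytope _ n x.
Bounded : ∀ {p} → ℕ → ℕ → Vec ℤ p → Set
Bounded lo hi x = ∀ i → InRange lo hi (lookup x i)

shift : ∀ {p} → ℕ → Vec ℤ p → Vec ℤ p
shift k = map (_+_ (+ k))

bounded-∷ : ∀ {p lo hi c} {x : Vec ℤ p} → lo ≤ c → c ≤ hi →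
            Bounded lo hi x → Bounded lo hi (+ c ∷ x)
bounded-∷ lo≤c c≤hi bx zero    = +≤+ lo≤c , +≤+ c≤hi
bounded-∷ lo≤c c≤hi bx (suc i) = bx i

bounded-head : ∀ {p lo hi c} {x : Vec ℤ p} → Bounded lo hi (+ c ∷ x) → lo ≤ c × c ≤ hi
bounded-head b with b zero
... | +≤+ lo≤c , +≤+ c≤hi = lo≤c , c≤hi

bounded-tail : ∀ {p lo hi c} {x : Vec ℤ p} → Bounded lo hi (c ∷ x) → Bounded lo hi x
bounded-tail b i = b (suc i)

data PunchInView {n} (u : Fin (suc n)) : Fin (suc n) → Set where
  at        : PunchInView u u
  punchedIn : ∀ a → PunchInView u (punchIn u a)

punchInView : ∀ {n} (u i : Fin (suc n)) → PunchInView u i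
punchInView u i with u ≟ᶠ i
... | yes refl = at
... | no u≢i   = subst (PunchInView u) (punchIn-punchOut u≢i) (punchedIn (punchOut u≢i))

insertAt-bounded : ∀ {p lo hi c} (x : Vec ℤ p) u → + lo ℤ.≤ c → c ℤ.≤ + hi →
                   Bounded lo hi x → Bounded lo hi (insertAt x u c)
insertAt-bounded {lo = lo} {hi} {c} x u lo≤c c≤hi bx i with punchInView u i
... | at          = subst (InRange lo hi) (sym (insertAt-lookup x u c)) (lo≤c , c≤hi)
... | punchedIn a = subst (InRange lo hi) (sym (insertAt-punchIn x u c a)) (bx a)

insertAt-bounded⁻ : ∀ {p lo hi c} (x : Vec ℤ p) u → Bounded lo hi (insertAt x u c) → Bounded lo hi x
insertAt-bounded⁻ {lo = lo} {hi} {c} x u b a =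
  subst (InRange lo hi) (insertAt-punchIn x u c a) (b (punchIn u a))

shift-insertAt : ∀ {p} k (x : Vec ℤ p) u → insertAt (shift k x) u (+ k) ≡ shift k (insertAt x u (+ 0))
shift-insertAt k x u = trans (cong (insertAt (shift k x) u) (sym (ℤₚ.+-identityʳ (+ k))))
                             (sym (map-insertAt (_+_ (+ k)) (+ 0) x u))

shift-zero : ∀ {p} (x : Vec ℤ p) → shift 0 x ≡ x
shift-zero []      = refl
shift-zero (a ∷ x) = cong₂ _∷_ (ℤₚ.+-identityˡ a) (shift-zero x)

∑-box-suc : ∀ n p (f : Vec ℤ (suc p) → ℤ) →
            ∑[ x ∈ box n (suc p) ] f x ≡ sumTo n (λ c → ∑[ y ∈ box n p ] f (+ c ∷ y))
∑-box-suc n p f = begin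
  ∑[ x ∈ box n (suc p) ] f x
    ≡⟨ ∑-concatMap (λ c → List.map (c ∷_) (box n p)) (List.map +_ (upTo (suc n))) f ⟩
  ∑[ c ∈ List.map +_ (upTo (suc n)) ] ∑[ y ∈ List.map (c ∷_) (box n p) ] f y
    ≡⟨ ∑-map +_ (upTo (suc n)) (λ c → ∑[ y ∈ List.map (c ∷_) (box n p) ] f y) ⟩
  ∑[ c ∈ upTo (suc n) ] ∑[ y ∈ List.map (+ c ∷_) (box n p) ] f y
    ≡⟨ ∑-applyUpTo n (λ c → c) (λ c → ∑[ y ∈ List.map (+ c ∷_) (box n p) ] f y) ⟩
  sumTo n (λ c → ∑[ y ∈ List.map (+ c ∷_) (box n p) ] f y)
    ≡⟨ sumTo-cong n (λ c _ → ∑-map (+ c ∷_) (box n p) f) ⟩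
  sumTo n (λ c → ∑[ y ∈ box n p ] f (+ c ∷ y))
    ∎

∑-box-cong : ∀ n p {f g : Vec ℤ p → ℤ} → (∀ x → Bounded 0 n x → f x ≡ g x) →
             ∑[ x ∈ box n p ] f x ≡ ∑[ x ∈ box n p ] g x
∑-box-cong n zero    f≗g = cong (_+ + 0) (f≗g [] (λ ()))
∑-box-cong n (suc p) {f} {g} f≗g = begin
  ∑[ x ∈ box n (suc p) ] f x                     ≡⟨ ∑-box-suc n p f ⟩
  sumTo n (λ c → ∑[ y ∈ box n p ] f (+ c ∷ y))  ≡⟨ sumTo-cong n pointwise ⟩
  sumTo n (λ c → ∑[ y ∈ box n p ] g (+ c ∷ y))  ≡⟨ ∑-box-suc n p g ⟨
  ∑[ x ∈ box n (suc p) ] g x                     ∎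
  where
  pointwise : ∀ c → c ≤ n → ∑[ y ∈ box n p ] f (+ c ∷ y) ≡ ∑[ y ∈ box n p ] g (+ c ∷ y)
  pointwise c c≤n = ∑-box-cong n p (λ y by → f≗g (+ c ∷ y) (bounded-∷ z≤n c≤n by))

∑-box-++ : ∀ n m q (f : Vec ℤ (m ℕ.+ q) → ℤ) →
           ∑[ z ∈ box n (m ℕ.+ q) ] f z ≡ ∑[ x ∈ box n m ] ∑[ y ∈ box n q ] f (x ++ y)
∑-box-++ n zero    q f = sym (ℤₚ.+-identityʳ _)
∑-box-++ n (suc m) q f = begin
  ∑[ z ∈ box n (suc m ℕ.+ q) ] f z
    ≡⟨ ∑-box-suc n (m ℕ.+ q) f ⟩
  sumTo n (λ c → ∑[ z ∈ box n (m ℕ.+ q) ] f (+ c ∷ z))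
    ≡⟨ sumTo-cong n (λ c _ → ∑-box-++ n m q (f ∘ (+ c ∷_))) ⟩
  sumTo n (λ c → ∑[ x ∈ box n m ] ∑[ y ∈ box n q ] f (+ c ∷ x ++ y))
    ≡⟨ ∑-box-suc n m (λ x → ∑[ y ∈ box n q ] f (x ++ y)) ⟨
  ∑[ x ∈ box n (suc m) ] ∑[ y ∈ box n q ] f (x ++ y)
    ∎

∑-box-insertAt : ∀ n p (u : Fin (suc p)) (f : Vec ℤ (suc p) → ℤ) →
                 ∑[ x ∈ box n (suc p) ] f x
                   ≡ sumTo n (λ c → ∑[ x ∈ box n p ] f (insertAt x u (+ c)))
∑-box-insertAt n p       zero    f = ∑-box-suc n p f
∑-box-insertAt n (suc p) (suc u) f = begin
  ∑[ x ∈ box n (suc (suc p)) ] f x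
    ≡⟨ ∑-box-suc n (suc p) f ⟩
  sumTo n (λ d → ∑[ y ∈ box n (suc p) ] f (+ d ∷ y))
    ≡⟨ sumTo-cong n (λ d _ → ∑-box-insertAt n p u (f ∘ (+ d ∷_))) ⟩
  sumTo n (λ d → sumTo n (λ c → ∑[ x ∈ box n p ] f (+ d ∷ insertAt x u (+ c))))
    ≡⟨ sumTo-comm n n _ ⟩
  sumTo n (λ c → sumTo n (λ d → ∑[ x ∈ box n p ] f (+ d ∷ insertAt x u (+ c))))
    ≡⟨ sumTo-cong n (λ c _ → ∑-box-suc n p (λ x → f (insertAt x (suc u) (+ c)))) ⟨
  sumTo n (λ c → ∑[ x ∈ box n (suc p) ] f (insertAt x (suc u) (+ c)))
    ∎

∑-box-shift : ∀ p lo {w n} (f : Vec ℤ p → ℤ) → lo ℕ.+ w ≤ n →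
              (∀ x → ¬ Bounded lo (lo ℕ.+ w) x → f x ≡ + 0) →
              ∑[ x ∈ box n p ] f x ≡ ∑[ x ∈ box w p ] f (shift lo x)
∑-box-shift zero    lo f le outside = refl
∑-box-shift (suc p) lo {w} {n} f le outside = begin
  ∑[ x ∈ box n (suc p) ] f x
    ≡⟨ ∑-box-suc n p f ⟩
  sumTo n (λ d → ∑[ y ∈ box n p ] f (+ d ∷ y))
    ≡⟨ sumTo-shift lo _ le (λ d d<lo → ∑-zero (box n p) (λ y → outside _ (too-small d<lo)))
                           (λ d d>hi → ∑-zero (box n p) (λ y → outside _ (too-large d>hi))) ⟩
  sumTo w (λ e → ∑[ y ∈ box n p ] f (+ (lo ℕ.+ e) ∷ y))
    ≡⟨ sumTo-cong w (λ e _ → ∑-box-shift p lo _ le (λ y ¬by → outside _ (¬by ∘ bounded-tail))) ⟩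
  sumTo w (λ e → ∑[ y ∈ box w p ] f (+ (lo ℕ.+ e) ∷ shift lo y))
    ≡⟨ ∑-box-suc w p (f ∘ shift lo) ⟨
  ∑[ x ∈ box w (suc p) ] f (shift lo x)
    ∎
  where
  too-small : ∀ {d} {y : Vec ℤ p} → d < lo → ¬ Bounded lo (lo ℕ.+ w) (+ d ∷ y)
  too-small d<lo b = ℕₚ.<⇒≱ d<lo (proj₁ (bounded-head b))
  too-large : ∀ {d} {y : Vec ℤ p} → lo ℕ.+ w < d → ¬ Bounded lo (lo ℕ.+ w) (+ d ∷ y)
  too-large d>hi b = ℕₚ.<⇒≱ d>hi (proj₂ (bounded-head b))

box-zero : ∀ p → box 0 p ≡ replicate p (+ 0) ∷ []
box-zero zero    = refl
box-zero (suc p) rewrite box-zero p = refl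

𝟙 : {P : Set} → Dec P → ℤ
𝟙 (yes _) = + 1
𝟙 (no _)  = + 0

𝟙-cong : {P Q : Set} → P ⇔ Q → (p : Dec P) (q : Dec Q) → 𝟙 p ≡ 𝟙 q
𝟙-cong P⇔Q (yes _) (yes _) = refl
𝟙-cong P⇔Q (yes x) (no ¬y) = ⊥-elim (¬y (Equivalence.to P⇔Q x))
𝟙-cong P⇔Q (no ¬x) (yes y) = ⊥-elim (¬x (Equivalence.from P⇔Q y))
𝟙-cong P⇔Q (no _)  (no _)  = refl

𝟙-yes : {P : Set} → P → (p : Dec P) → 𝟙 p ≡ + 1
𝟙-yes x (yes _) = refl
𝟙-yes x (no ¬x) = ⊥-elim (¬x x)

𝟙-no : {P : Set} → ¬ P → (p : Dec P) → 𝟙 p ≡ + 0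
𝟙-no ¬x (yes x) = ⊥-elim (¬x x)
𝟙-no ¬x (no _)  = refl

𝟙-×-dec : {P Q : Set} (p : Dec P) (q : Dec Q) → 𝟙 (p ×-dec q) ≡ 𝟙 p * 𝟙 q
𝟙-×-dec (yes _) (yes _) = refl
𝟙-×-dec (yes _) (no _)  = refl
𝟙-×-dec (no _)  _       = refl

+length-filter : ∀ {A : Set} {P : A → Set} (P? : ∀ x → Dec (P x)) xs →
                 + length (filter P? xs) ≡ ∑[ x ∈ xs ] 𝟙 (P? x)
+length-filter P? []       = refl
+length-filter P? (x ∷ xs) with P? x
... | yes _ = cong (_+_ (+ 1)) (+length-filter P? xs)
... | no _  = trans (+length-filter P? xs) (sym (ℤₚ.+-identityˡ _))

module _ {p} {R : Rel (Fin p) 0ℓ} where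

  private
    InO = InDilatedOrderPolytope R

  origin∈O : InO 0 (replicate p (+ 0))
  origin∈O = (λ i → subst (InRange 0 0) (sym (0ᵢ i)) (ℤₚ.≤-refl , ℤₚ.≤-refl))
           , (λ i j _ → ℤₚ.≤-reflexive (trans (0ᵢ i) (sym (0ᵢ j))))
    where
    0ᵢ : ∀ i → lookup (replicate p (+ 0)) i ≡ + 0
    0ᵢ i = lookup-replicate i (+ 0)

  +ehrO≡∑box : (R? : Decidable R) → ∀ n →
               + ehrO R? n ≡ ∑[ x ∈ box n p ] 𝟙 (inDilated? R? n x)
  +ehrO≡∑box R? n = +length-filter (inDilated? R? n) (box n p)

  EhrO≡ehrO : (R? : Decidable R) → ∀ n → EhrO R? n ≡ + ehrO R? n
  EhrO≡ehrO R? (suc n) = refl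
  EhrO≡ehrO R? zero    = sym (begin
    + ehrO R? 0                               ≡⟨ +ehrO≡∑box R? 0 ⟩
    ∑[ x ∈ box 0 p ] 𝟙 (inDilated? R? 0 x)    ≡⟨ cong (λ xs → ∑[ x ∈ xs ] 𝟙 (inDilated? R? 0 x)) (box-zero p) ⟩
    𝟙 (inDilated? R? 0 origin) + + 0          ≡⟨ cong (_+ + 0) (𝟙-yes origin∈O (inDilated? R? 0 origin)) ⟩
    + 1                                       ∎)
    where
    origin = replicate p (+ 0)

  inDilated-mono : ∀ {k n} (y : Vec ℤ p) → k ≤ n → InO k y → InO n y
  inDilated-mono y k≤n (bounds , order) =
    (λ i → proj₁ (bounds i) , ℤₚ.≤-trans (proj₂ (bounds i)) (+≤+ k≤n)) , order

  order-greatest : ∀ {n} (y : Vec ℤ p) u → (∀ s → R s u) → InO n y → ∀ i → lookup y i ℤ.≤ lookup y u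
  order-greatest y u greatest (_ , order) i with i ≟ᶠ u
  ... | yes refl = ℤₚ.≤-refl
  ... | no i≢u   = order i u (greatest i , i≢u)

  order-least : ∀ {n} (y : Vec ℤ p) v → (∀ s → R v s) → InO n y → ∀ i → lookup y v ℤ.≤ lookup y i
  order-least y v least (_ , order) i with v ≟ᶠ i
  ... | yes refl = ℤₚ.≤-refl
  ... | no v≢i   = order v i (least i , v≢i)

  inDilated-greatest : ∀ {k n} (y : Vec ℤ p) u → (∀ s → R s u) → lookup y u ≡ + k → InO n y → InO k y
  inDilated-greatest y u greatest yᵤ≡k y∈O@(bounds , order) =
    (λ i → proj₁ (bounds i) , subst (lookup y i ℤ.≤_) yᵤ≡k (order-greatest y u greatest y∈O i)) , order

  inDilated-least : ∀ {k n} (y : Vec ℤ p) v → (∀ s → R v s) → lookup y v ≡ + k → InO n y → Bounded k n y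
  inDilated-least y v least yᵥ≡k y∈O@(bounds , _) i =
    subst (ℤ._≤ lookup y i) yᵥ≡k (order-least y v least y∈O i) , proj₂ (bounds i)

  inDilated-shift : ∀ {k n} (y : Vec ℤ p) → k ≤ n → (∀ i → + 0 ℤ.≤ lookup y i) →
                    InO n (shift k y) ⇔ InO (n ∸ k) y
  inDilated-shift {k} {n} y k≤n 0≤y = mk⇔ to from
    where
    shifted : ∀ i → lookup (shift k y) i ≡ + k + lookup y i
    shifted i = lookup-map i (_+_ (+ k)) y
    +n : + n ≡ + k + + (n ∸ k)
    +n = trans (cong +_ (sym (ℕₚ.m+[n∸m]≡n k≤n))) (ℤₚ.pos-+ k (n ∸ k))
    cancel : ∀ {a b} → + k + a ℤ.≤ + k + b → a ℤ.≤ b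
    cancel {a} {b} le =
      subst₂ ℤ._≤_ (neg-cancel (+ k) a) (neg-cancel (+ k) b) (ℤₚ.+-monoʳ-≤ (- + k) le)
      where
      neg-cancel : ∀ c x → - c + (c + x) ≡ x
      neg-cancel = solve-∀
    to : InO n (shift k y) → InO (n ∸ k) y
    to (bounds , order) =
      (λ i → 0≤y i , cancel (subst₂ ℤ._≤_ (shifted i) +n (proj₂ (bounds i))))
      , (λ i j i≺j → cancel (subst₂ ℤ._≤_ (shifted i) (shifted j) (order i j i≺j)))
    from : InO (n ∸ k) y → InO n (shift k y)
    from (bounds , order) =
      (λ i → subst (InRange 0 n) (sym (shifted i))
               ( ℤₚ.+-mono-≤ (+≤+ z≤n) (0≤y i)
               , subst (+ k + lookup y i ℤ.≤_) (sym +n) (ℤₚ.+-monoʳ-≤ (+ k) (proj₂ (bounds i)))))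
      , (λ i j i≺j → subst₂ ℤ._≤_ (sym (shifted i)) (sym (shifted j)) (ℤₚ.+-monoʳ-≤ (+ k) (order i j i≺j)))

-- Extremal elements of finite posets

module _ {p} {_≼_ : Rel (Fin p) 0ℓ} (isPartialOrder : IsPartialOrder _≡_ _≼_) (_≼?_ : Decidable _≼_)
  where

  private
    module ≼ = IsPartialOrder isPartialOrder

  unique-maximal⇒greatest : ∀ u → (∀ w → (∀ t → ¬ Strict _≼_ w t) → w ≡ u) → ∀ s → s ≼ u
  unique-maximal⇒greatest u unique s = climb s (po-noetherian isPartialOrder s)
    where
    climb : ∀ s → Acc (flip (Strict _≼_)) s → s ≼ u
    climb s (acc above) with any? (λ t → strict? _≼?_ s t)
    ... | yes (t , s≺t) = ≼.trans (proj₁ s≺t) (climb t (above s≺t))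
    ... | no ∄t         = ≼.reflexive (unique s (λ t s≺t → ∄t (t , s≺t)))

module _ {p} (P : FinPoset p) where
  open FinPoset P

  UniqueMaximal⇒greatest : ∀ {u} → UniqueMaximal P u → ∀ s → s ≼ u
  UniqueMaximal⇒greatest {u} (_ , unique) = unique-maximal⇒greatest isPartialOrder _≼?_ u unique

  UniqueMinimal⇒least : ∀ {v} → UniqueMinimal P v → ∀ s → v ≼ s
  UniqueMinimal⇒least {v} (_ , unique) =
    unique-maximal⇒greatest (Flip.isPartialOrder isPartialOrder) (flip _≼?_) v
      (λ w w-maximal → unique w (λ t (t≼w , t≢w) → w-maximal t (t≼w , t≢w ∘ sym)))

-- Fibres and gluing

module Fibres {p} {R : Rel (Fin (suc p)) 0ℓ} (R? : Decidable R) (u : Fin (suc p)) where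

  private
    InO = InDilatedOrderPolytope R

  fibre : ℕ → ℕ → ℤ
  fibre n k = ∑[ x ∈ box n p ] 𝟙 (inDilated? R? n (insertAt x u (+ k)))

  +ehrO≡∑fibre : ∀ n → + ehrO R? n ≡ sumTo n (fibre n)
  +ehrO≡∑fibre n = trans (+ehrO≡∑box R? n) (∑-box-insertAt n p u (𝟙 ∘ inDilated? R? n))

  fibre-greatest : (∀ s → R s u) → ∀ {k n} → k ≤ n → fibre n k ≡ fibre k k
  fibre-greatest greatest {k} {n} k≤n = begin
    ∑[ x ∈ box n p ] member n x            ≡⟨ ∑-cong (box n p) (λ x → 𝟙-cong (top-fibre x) _ _) ⟩
    ∑[ x ∈ box n p ] member k x            ≡⟨ ∑-box-shift p 0 (member k) k≤n outside ⟩
    ∑[ x ∈ box k p ] member k (shift 0 x)  ≡⟨ ∑-cong (box k p) (cong (member k) ∘ shift-zero) ⟩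
    ∑[ x ∈ box k p ] member k x            ∎
    where
    y : Vec ℤ p → Vec ℤ (suc p)
    y x = insertAt x u (+ k)
    member : ℕ → Vec ℤ p → ℤ
    member j x = 𝟙 (inDilated? R? j (y x))
    top-fibre : ∀ x → InO n (y x) ⇔ InO k (y x)
    top-fibre x = mk⇔ (inDilated-greatest (y x) u greatest (insertAt-lookup x u (+ k)))
                      (inDilated-mono (y x) k≤n)
    outside : ∀ x → ¬ Bounded 0 k x → member k x ≡ + 0
    outside x ¬bx = 𝟙-no (λ yx∈O → ¬bx (insertAt-bounded⁻ x u (proj₁ yx∈O))) _

  fibre-least : (∀ s → R u s) → ∀ {k n} → k ≤ n → fibre n k ≡ fibre (n ∸ k) 0
  fibre-least least {k} {n} k≤n = begin
    ∑[ x ∈ box n p ] member n k x                        ≡⟨ ∑-box-shift p k (member n k) k+[n∸k]≤n outside ⟩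
    ∑[ x ∈ box (n ∸ k) p ] member n k (shift k x)        ≡⟨ ∑-box-cong (n ∸ k) p translate ⟩
    ∑[ x ∈ box (n ∸ k) p ] member (n ∸ k) 0 x            ∎
    where
    member : ℕ → ℕ → Vec ℤ p → ℤ
    member j c x = 𝟙 (inDilated? R? j (insertAt x u (+ c)))
    k+[n∸k]≡n : k ℕ.+ (n ∸ k) ≡ n
    k+[n∸k]≡n = ℕₚ.m+[n∸m]≡n k≤n
    k+[n∸k]≤n : k ℕ.+ (n ∸ k) ≤ n
    k+[n∸k]≤n = ℕₚ.≤-reflexive k+[n∸k]≡n
    outside : ∀ x → ¬ Bounded k (k ℕ.+ (n ∸ k)) x → member n k x ≡ + 0
    outside x ¬bx = 𝟙-no (λ y∈O → ¬bx (subst (λ hi → Bounded k hi x) (sym k+[n∸k]≡n) (insertAt-bounded⁻ x u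
                      (inDilated-least (insertAt x u (+ k)) u least (insertAt-lookup x u (+ k)) y∈O)))) _
    translate : ∀ x → Bounded 0 (n ∸ k) x → member n k (shift k x) ≡ member (n ∸ k) 0 x
    translate x bx = 𝟙-cong (subst (λ y → InO n y ⇔ InO (n ∸ k) y₀) (sym (shift-insertAt k x u))
                                   (inDilated-shift y₀ k≤n (proj₁ ∘ insertAt-bounded x u ℤₚ.≤-refl (+≤+ z≤n) bx))) _ _
      where
      y₀ = insertAt x u (+ 0)

data ++View (m q : ℕ) : Fin (m ℕ.+ q) → Set where
  left  : ∀ a → ++View m q (a ↑ˡ q)
  right : ∀ b → ++View m q (m ↑ʳ b)

++view : ∀ m {q} (s : Fin (m ℕ.+ q)) → ++View m q s
++view m {q} s with splitAt m {q} s in eq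
... | inj₁ a = subst (++View m q) (splitAt⁻¹-↑ˡ eq) (left a)
... | inj₂ b = subst (++View m q) (splitAt⁻¹-↑ʳ eq) (right b)

↑ˡ≢↑ʳ : ∀ {m q} (a : Fin m) (b : Fin q) → a ↑ˡ q ≢ m ↑ʳ b
↑ˡ≢↑ʳ {m} {q} a b eq with trans (sym (splitAt-↑ˡ m a q)) (trans (cong (splitAt m) eq) (splitAt-↑ʳ m q b))
... | ()

module Gluing {m q} (P₁ : FinPoset (suc m)) (u : Fin (suc m)) (P₂ : FinPoset (suc q)) (v : Fin (suc q))
  where

  open FinPoset P₁ using ()
    renaming (_≼_ to _≼₁_; _≼?_ to _≼₁?_; isPartialOrder to isPartialOrder₁)
  open FinPoset P₂ using () renaming (_≼_ to _≼₂_; _≼?_ to _≼₂?_)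

  private
    _≼_ = GlueRel P₁ u P₂

  glue-ˡˡ : ∀ a b → (a ↑ˡ suc q) ≼ (b ↑ˡ suc q) ⇔ punchIn u a ≼₁ punchIn u b
  glue-ˡˡ a b rewrite splitAt-↑ˡ m a (suc q) | splitAt-↑ˡ m b (suc q) = mk⇔ (λ r → r) (λ r → r)

  glue-ʳʳ : ∀ a b → (m ↑ʳ a) ≼ (m ↑ʳ b) ⇔ a ≼₂ b
  glue-ʳʳ a b rewrite splitAt-↑ʳ m (suc q) a | splitAt-↑ʳ m (suc q) b = mk⇔ (λ r → r) (λ r → r)

  glue-ˡʳ : ∀ a b → (a ↑ˡ suc q) ≼ (m ↑ʳ b)
  glue-ˡʳ a b rewrite splitAt-↑ˡ m a (suc q) | splitAt-↑ʳ m (suc q) b = _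

  glue-ʳˡ : ∀ a b → ¬ (m ↑ʳ a) ≼ (b ↑ˡ suc q)
  glue-ʳˡ a b rewrite splitAt-↑ʳ m (suc q) a | splitAt-↑ˡ m b (suc q) = λ ()

  module Counting (u-greatest : ∀ s → s ≼₁ u) (v-least : ∀ t → v ≼₂ t) where

    private
      InO  = InDilatedOrderPolytope _≼_
      InO₁ = InDilatedOrderPolytope _≼₁_
      InO₂ = InDilatedOrderPolytope _≼₂_

    module _ {n : ℕ} (x₁ : Vec ℤ m) (x₂ : Vec ℤ (suc q)) where

      private
        y = insertAt x₁ u (lookup x₂ v)
        z = x₁ ++ x₂

        zˡ : ∀ a → lookup z (a ↑ˡ suc q) ≡ lookup y (punchIn u a)
        zˡ a = trans (lookup-++ˡ x₁ x₂ a) (sym (insertAt-punchIn x₁ u _ a))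

        zʳ : ∀ b → lookup z (m ↑ʳ b) ≡ lookup x₂ b
        zʳ = lookup-++ʳ x₁ x₂

        yᵤ : lookup y u ≡ lookup x₂ v
        yᵤ = insertAt-lookup x₁ u _

      glue-split : InO n z → InO₁ n y × InO₂ n x₂
      glue-split (bounds , order) = (bounds₁ , order₁) , (bounds₂ , order₂)
        where
        bounds₁ : Bounded 0 n y
        bounds₁ i with punchInView u i
        ... | at          = subst (InRange 0 n) (trans (zʳ v) (sym yᵤ)) (bounds (m ↑ʳ v))
        ... | punchedIn a = subst (InRange 0 n) (zˡ a) (bounds (a ↑ˡ suc q))
        order₁ : ∀ i j → Strict _≼₁_ i j → lookup y i ℤ.≤ lookup y j
        order₁ i j i≺j with punchInView u i | punchInView u j
        order₁ _ j (u≼j , u≢j) | at | _ =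
          ⊥-elim (u≢j (IsPartialOrder.antisym isPartialOrder₁ u≼j (u-greatest j)))
        order₁ _ _ _ | punchedIn a | at =
          subst₂ ℤ._≤_ (zˡ a) (trans (zʳ v) (sym yᵤ))
            (order (a ↑ˡ suc q) (m ↑ʳ v) (glue-ˡʳ a v , ↑ˡ≢↑ʳ a v))
        order₁ _ _ (a≼b , a≢b) | punchedIn a | punchedIn b =
          subst₂ ℤ._≤_ (zˡ a) (zˡ b)
            (order (a ↑ˡ suc q) (b ↑ˡ suc q)
              (Equivalence.from (glue-ˡˡ a b) a≼b , a≢b ∘ cong (punchIn u) ∘ ↑ˡ-injective (suc q) a b))
        bounds₂ : Bounded 0 n x₂
        bounds₂ b = subst (InRange 0 n) (zʳ b) (bounds (m ↑ʳ b))
        order₂ : ∀ a b → Strict _≼₂_ a b → lookup x₂ a ℤ.≤ lookup x₂ b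
        order₂ a b (a≼b , a≢b) =
          subst₂ ℤ._≤_ (zʳ a) (zʳ b)
            (order (m ↑ʳ a) (m ↑ʳ b) (Equivalence.from (glue-ʳʳ a b) a≼b , a≢b ∘ ↑ʳ-injective m a b))

      glue-join : InO₁ n y × InO₂ n x₂ → InO n z
      glue-join (y∈O₁@(bounds₁ , order₁) , x₂∈O₂@(bounds₂ , order₂)) = bounds , order
        where
        bounds : Bounded 0 n z
        bounds s with ++view m s
        ... | left a  = subst (InRange 0 n) (sym (zˡ a)) (bounds₁ (punchIn u a))
        ... | right b = subst (InRange 0 n) (sym (zʳ b)) (bounds₂ b)
        order : ∀ s t → Strict _≼_ s t → lookup z s ℤ.≤ lookup z t
        order s t s≺t with ++view m s | ++view m t
        order _ _ (s≼t , s≢t) | left a | left b =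
          subst₂ ℤ._≤_ (sym (zˡ a)) (sym (zˡ b))
            (order₁ (punchIn u a) (punchIn u b)
              (Equivalence.to (glue-ˡˡ a b) s≼t , s≢t ∘ cong (_↑ˡ suc q) ∘ punchIn-injective u a b))
        order _ _ _ | left a | right b =
          subst₂ ℤ._≤_ (sym (zˡ a)) (sym (zʳ b))
            (ℤₚ.≤-trans
              (subst (lookup y (punchIn u a) ℤ.≤_) yᵤ (order-greatest y u u-greatest y∈O₁ (punchIn u a)))
              (order-least x₂ v v-least x₂∈O₂ b))
        order _ _ (s≼t , _) | right a | left b = ⊥-elim (glue-ʳˡ a b s≼t)
        order _ _ (s≼t , s≢t) | right a | right b =
          subst₂ ℤ._≤_ (sym (zʳ a)) (sym (zʳ b))
            (order₂ a b (Equivalence.to (glue-ʳʳ a b) s≼t , s≢t ∘ cong (m ↑ʳ_)))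

    private
      _≼?_ = glueRel? P₁ u P₂
      module F₁ = Fibres _≼₁?_ u
      module F₂ = Fibres _≼₂?_ v

    +ehrO-glue : ∀ n → + ehrO _≼?_ n ≡ sumTo n (λ k → F₁.fibre n k * F₂.fibre n k)
    +ehrO-glue n = begin
      + ehrO _≼?_ n
        ≡⟨ +ehrO≡∑box _≼?_ n ⟩
      ∑[ z ∈ box n (m ℕ.+ suc q) ] 𝟙 (inDilated? _≼?_ n z)
        ≡⟨ ∑-box-++ n m (suc q) (𝟙 ∘ inDilated? _≼?_ n) ⟩
      ∑[ x₁ ∈ box n m ] ∑[ x₂ ∈ box n (suc q) ] 𝟙 (inDilated? _≼?_ n (x₁ ++ x₂))
        ≡⟨ ∑-cong (box n m) (λ x₁ → ∑-cong (box n (suc q)) (factor x₁)) ⟩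
      ∑[ x₁ ∈ box n m ] ∑[ x₂ ∈ box n (suc q) ] member₁ (lookup x₂ v) x₁ * member₂ x₂
        ≡⟨ ∑-comm (box n m) (box n (suc q)) _ ⟩
      ∑[ x₂ ∈ box n (suc q) ] ∑[ x₁ ∈ box n m ] member₁ (lookup x₂ v) x₁ * member₂ x₂
        ≡⟨ ∑-cong (box n (suc q)) (λ x₂ → ∑-*ʳ (box n m) (member₂ x₂) _) ⟩
      ∑[ x₂ ∈ box n (suc q) ] fibre₁ (lookup x₂ v) * member₂ x₂
        ≡⟨ ∑-box-insertAt n q v _ ⟩
      sumTo n (λ k → ∑[ x ∈ box n q ] fibre₁ (lookup (insertAt x v (+ k)) v) * member₂ (insertAt x v (+ k)))
        ≡⟨ sumTo-cong n (λ k _ → ∑-cong (box n q) (λ x →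
             cong (λ c → fibre₁ c * member₂ (insertAt x v (+ k))) (insertAt-lookup x v (+ k)))) ⟩
      sumTo n (λ k → ∑[ x ∈ box n q ] F₁.fibre n k * member₂ (insertAt x v (+ k)))
        ≡⟨ sumTo-cong n (λ k _ → ∑-*ˡ (box n q) (F₁.fibre n k) _) ⟩
      sumTo n (λ k → F₁.fibre n k * F₂.fibre n k)
        ∎
      where
      member₁ : ℤ → Vec ℤ m → ℤ
      member₁ c x₁ = 𝟙 (inDilated? _≼₁?_ n (insertAt x₁ u c))
      member₂ : Vec ℤ (suc q) → ℤ
      member₂ x₂ = 𝟙 (inDilated? _≼₂?_ n x₂)
      fibre₁ : ℤ → ℤ
      fibre₁ c = ∑[ x₁ ∈ box n m ] member₁ c x₁
      factor : ∀ x₁ x₂ → 𝟙 (inDilated? _≼?_ n (x₁ ++ x₂)) ≡ member₁ (lookup x₂ v) x₁ * member₂ x₂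
      factor x₁ x₂ = trans (𝟙-cong (mk⇔ (glue-split x₁ x₂) (glue-join x₁ x₂)) _ (p₁ ×-dec p₂)) (𝟙-×-dec p₁ p₂)
        where
        p₁ = inDilated? _≼₁?_ n (insertAt x₁ u (lookup x₂ v))
        p₂ = inDilated? _≼₂?_ n x₂

    α β : Series
    α k = F₁.fibre k k
    β k = F₂.fibre k 0

    EhrO₁≡partialSums : ∀ n → EhrO _≼₁?_ n ≡ partialSums α n
    EhrO₁≡partialSums n = begin
      EhrO _≼₁?_ n           ≡⟨ EhrO≡ehrO _≼₁?_ n ⟩
      + ehrO _≼₁?_ n         ≡⟨ F₁.+ehrO≡∑fibre n ⟩
      sumTo n (F₁.fibre n)   ≡⟨ sumTo-cong n (λ k → F₁.fibre-greatest u-greatest) ⟩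
      sumTo n α              ∎

    EhrO₂≡partialSums : ∀ n → EhrO _≼₂?_ n ≡ partialSums β n
    EhrO₂≡partialSums n = begin
      EhrO _≼₂?_ n               ≡⟨ EhrO≡ehrO _≼₂?_ n ⟩
      + ehrO _≼₂?_ n             ≡⟨ F₂.+ehrO≡∑fibre n ⟩
      sumTo n (F₂.fibre n)       ≡⟨ sumTo-cong n (λ k → F₂.fibre-least v-least) ⟩
      sumTo n (λ k → β (n ∸ k))  ≡⟨ sumTo-reverse n β ⟨
      sumTo n β                  ∎

    EhrO-glue≡⊛ : ∀ n → EhrO _≼?_ n ≡ (α ⊛ β) n
    EhrO-glue≡⊛ n = begin
      EhrO _≼?_ n                                  ≡⟨ EhrO≡ehrO _≼?_ n ⟩
      + ehrO _≼?_ n                                ≡⟨ +ehrO-glue n ⟩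
      sumTo n (λ k → F₁.fibre n k * F₂.fibre n k)  ≡⟨ sumTo-cong n (λ k k≤n → cong₂ _*_
                                                        (F₁.fibre-greatest u-greatest k≤n)
                                                        (F₂.fibre-least v-least k≤n)) ⟩
      (α ⊛ β) n                                    ∎

corollary2p7 : (m q : ℕ) (P₁ : FinPoset (suc m)) (P₂ : FinPoset q)
               (u : Fin (suc m)) (v : Fin q) →
               UniqueMaximal P₁ u → UniqueMinimal P₂ v →
               ∀ n → EhrO (glueRel? P₁ u P₂) n
                     ≡ ((EhrO (FinPoset._≼?_ P₁) ⊛ EhrO (FinPoset._≼?_ P₂)) ⊛ oneMinusXSq) n
corollary2p7 m zero    P₁ P₂ u ()
corollary2p7 m (suc q) P₁ P₂ u v u-max v-min n = begin
  EhrO (glueRel? P₁ u P₂) n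
    ≡⟨ EhrO-glue≡⊛ n ⟩
  (α ⊛ β) n
    ≡⟨ partialSums-⊛-oneMinusXSq α β n ⟨
  ((partialSums α ⊛ partialSums β) ⊛ oneMinusXSq) n
    ≡⟨ ⊛-cong {b = oneMinusXSq} (⊛-cong (sym ∘ EhrO₁≡partialSums) (sym ∘ EhrO₂≡partialSums)) (λ _ → refl) n ⟩
  ((EhrO (FinPoset._≼?_ P₁) ⊛ EhrO (FinPoset._≼?_ P₂)) ⊛ oneMinusXSq) n
    ∎
  where
  open Gluing.Counting P₁ u P₂ v (UniqueMaximal⇒greatest P₁ u-max) (UniqueMinimal⇒least P₂ v-min)
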